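{- Let $$F(x,y,z)=\sum_{\ell\ge0}\sum_{m\ge0}\sum_{k\ge0}\frac{\ell+1}{k+\ell+1}\binom{k+\ell+m}{k+\ell}\binom{2k+\ell+m}{k+\ell+m}x^ky^\ell z^m$$ and $$f(x,z)=\sum_{m\ge0}\sum_{k\ge0}\frac{1}{k+1}\binom{m+k}{k}\binom{2k+m+2}{k}x^kz^m,$$ as formal power series. Then $F(x,x,z)=f(x,z)$. -}

module Defs where

open import Data.Nat using (ℕ; suc; _∸_) renaming (_+_ to _+ℕ_; _*_ to _*ℕ_)
open import Data.Nat.Combinatorics using (_C_)
open import Data.Integer using (+_)
open import Data.Rational using (ℚ; _/_; 0ℚ; _+_; _*_)
open import Data.List using (List; map; foldr; upTo)

-- A formal power series in x,y,z (resp. x,z) over ℚ, given by its coefficients: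
-- S k ℓ m is the coefficient of x^k y^ℓ z^m  (resp. S k m of x^k z^m).
FPS3 : Set
FPS3 = ℕ → ℕ → ℕ → ℚ

FPS2 : Set
FPS2 = ℕ → ℕ → ℚ

ℕ→ℚ : ℕ → ℚ
ℕ→ℚ n = + n / 1

F : FPS3
F k ℓ m = ((+ (ℓ +ℕ 1)) / (suc (k +ℕ ℓ)))
          * ℕ→ℚ (((k +ℕ ℓ +ℕ m) C (k +ℕ ℓ)) *ℕ ((2 *ℕ k +ℕ ℓ +ℕ m) C (k +ℕ ℓ +ℕ m)))

f : FPS2
f k m = ((+ 1) / (suc k))
        * ℕ→ℚ (((m +ℕ k) C k) *ℕ ((2 *ℕ k +ℕ m +ℕ 2) C k))

subst-y≔x : FPS3 → FPS2
subst-y≔x S n m = foldr _+_ 0ℚ (map (λ k → S k (n ∸ k) m) (upTo (suc n)))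

{-# OPTIONS --safe #-}
-- On the antidiagonal k + ℓ = n every term of F(x,x,z) has the common denominator
-- n + 1, with numerator C(n+m,n) (ℓ+1) C(n+m+k,k). The weight ℓ + 1 = n − k + 1
-- counts the partial sums Σ_{k ≤ j} C(n+m+k,k), j = k..n, that contain the k-th
-- term, so the hockey-stick identity Σ_{k ≤ j} C(a+k,k) = C(a+1+j,j), applied
-- once to each partial sum and once to their sum, gives C(2n+m+2,n).
module Submission where

open import Defs
open import Function using (_∘_; id)
open import Relation.Binary.PropositionalEquality
open import Data.Nat using (ℕ; zero; suc; _∸_; _<_; s≤s⁻¹)
  renaming (_+_ to _+ℕ_; _*_ to _*ℕ_)
open import Data.Nat.Properties using (+-comm; +-suc; +-identityʳ; *-distribˡ-+; *-zeroʳ; m+[n∸m]≡n; m≤m+n; m+n∸m≡n)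
open import Data.Nat.Combinatorics using (_C_; nCk+nC[k+1]≡[n+1]C[k+1]; nCk≡nC[n∸k])
open import Data.Nat.ListAction using (sum)
open import Data.Nat.ListAction.Properties using (sum-++)
open import Data.Nat.Tactic.RingSolver using (solve-∀)
open import Data.Integer as ℤ using (ℤ; +_)
open import Data.Integer.Properties using (pos-+; pos-*) renaming (*-identityˡ to ℤ-*-identityˡ)
import Data.Integer.Tactic.RingSolver as ℤ-Solver
open import Data.Rational using (ℚ; _/_; 0ℚ; _+_; _*_; toℚᵘ)
open import Data.Rational.Properties using (toℚᵘ-injective; toℚᵘ-fromℚᵘ; toℚᵘ-homo-+; toℚᵘ-homo-*; 0/n≡0)
import Data.Rational.Unnormalised as ℚᵘ
open import Data.Rational.Unnormalised.Properties using (+-cong; *-cong; ≃-sym; module ≃-Reasoning)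
open import Data.List using (map; foldr; upTo; applyUpTo; _∷_; []; _∷ʳ_)
open import Data.List.Properties using (applyUpTo-∷ʳ; map-upTo; map-∘; map-cong-local)
open import Data.List.Relation.Unary.All.Properties using (applyUpTo⁺₁)

toℚᵘ-/ : ∀ (i : ℤ) d → toℚᵘ (i / suc d) ℚᵘ.≃ i ℚᵘ./ suc d
toℚᵘ-/ i d = toℚᵘ-fromℚᵘ (i ℚᵘ./ suc d)

[i+j]/d≡i/d+j/d : ∀ (i j : ℤ) d → (i ℤ.+ j) / suc d ≡ i / suc d + j / suc d
[i+j]/d≡i/d+j/d i j d = toℚᵘ-injective (begin
  toℚᵘ ((i ℤ.+ j) / suc d)                 ≈⟨ toℚᵘ-/ (i ℤ.+ j) d ⟩
  (i ℤ.+ j) ℚᵘ./ suc d                     ≈⟨ ℚᵘ.*≡* (common-denominator i j (+ suc d)) ⟩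
  i ℚᵘ./ suc d ℚᵘ.+ j ℚᵘ./ suc d           ≈⟨ ≃-sym (+-cong (toℚᵘ-/ i d) (toℚᵘ-/ j d)) ⟩
  toℚᵘ (i / suc d) ℚᵘ.+ toℚᵘ (j / suc d)   ≈⟨ ≃-sym (toℚᵘ-homo-+ (i / suc d) (j / suc d)) ⟩
  toℚᵘ (i / suc d + j / suc d)             ∎)
  where
  open ≃-Reasoning
  common-denominator : ∀ i j D → (i ℤ.+ j) ℤ.* (D ℤ.* D) ≡ (i ℤ.* D ℤ.+ j ℤ.* D) ℤ.* D
  common-denominator = ℤ-Solver.solve-∀

[i/d]*[j/1]≡[i*j]/d : ∀ (i j : ℤ) d → (i / suc d) * (j / 1) ≡ (i ℤ.* j) / suc d
[i/d]*[j/1]≡[i*j]/d i j d = toℚᵘ-injective (begin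
  toℚᵘ (i / suc d * (j / 1))               ≈⟨ toℚᵘ-homo-* (i / suc d) (j / 1) ⟩
  toℚᵘ (i / suc d) ℚᵘ.* toℚᵘ (j / 1)       ≈⟨ *-cong (toℚᵘ-/ i d) (toℚᵘ-/ j 0) ⟩
  i ℚᵘ./ suc d ℚᵘ.* (j ℚᵘ./ 1)             ≈⟨ ℚᵘ.*≡* (denominator-times-one i j (+ suc d)) ⟩
  (i ℤ.* j) ℚᵘ./ suc d                     ≈⟨ ≃-sym (toℚᵘ-/ (i ℤ.* j) d) ⟩
  toℚᵘ ((i ℤ.* j) / suc d)                 ∎)
  where
  open ≃-Reasoning
  denominator-times-one : ∀ i j D → (i ℤ.* j) ℤ.* D ≡ (i ℤ.* j) ℤ.* (D ℤ.* ℤ.1ℤ)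
  denominator-times-one = ℤ-Solver.solve-∀

foldr-+-map-/ : ∀ d ns → foldr _+_ 0ℚ (map (λ a → + a / suc d) ns) ≡ + sum ns / suc d
foldr-+-map-/ d []       = sym (0/n≡0 (suc d))
foldr-+-map-/ d (a ∷ ns) = begin
  + a / suc d + foldr _+_ 0ℚ (map (λ a → + a / suc d) ns) ≡⟨ cong (_+_ (+ a / suc d)) (foldr-+-map-/ d ns) ⟩
  + a / suc d + + sum ns / suc d                          ≡⟨ [i+j]/d≡i/d+j/d (+ a) (+ sum ns) d ⟨
  (+ a ℤ.+ + sum ns) / suc d                              ≡⟨ cong (_/ suc d) (pos-+ a (sum ns)) ⟨
  + (a +ℕ sum ns) / suc d                                 ∎
  where open ≡-Reasoning

applyUpTo-cong : ∀ {A : Set} {f g : ℕ → A} → (∀ k → f k ≡ g k) → ∀ n → applyUpTo f n ≡ applyUpTo g n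
applyUpTo-cong f≗g zero    = refl
applyUpTo-cong f≗g (suc n) = cong₂ _∷_ (f≗g 0) (applyUpTo-cong (f≗g ∘ suc) n)

sum-applyUpTo-suc : ∀ f n → sum (applyUpTo f (suc n)) ≡ sum (applyUpTo f n) +ℕ f n
sum-applyUpTo-suc f n = begin
  sum (applyUpTo f (suc n))                ≡⟨ cong sum (applyUpTo-∷ʳ f n) ⟨
  sum (applyUpTo f n ∷ʳ f n)               ≡⟨ sum-++ (applyUpTo f n) (f n ∷ []) ⟩
  sum (applyUpTo f n) +ℕ (f n +ℕ 0)        ≡⟨ cong (sum (applyUpTo f n) +ℕ_) (+-identityʳ (f n)) ⟩
  sum (applyUpTo f n) +ℕ f n               ∎
  where open ≡-Reasoning

sum-applyUpTo-+ : ∀ f g n → sum (applyUpTo (λ k → f k +ℕ g k) n) ≡ sum (applyUpTo f n) +ℕ sum (applyUpTo g n)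
sum-applyUpTo-+ f g zero    = refl
sum-applyUpTo-+ f g (suc n) =
  trans (cong (f 0 +ℕ g 0 +ℕ_) (sum-applyUpTo-+ (f ∘ suc) (g ∘ suc) n)) (interchange (f 0) (g 0) _ _)
  where
  interchange : ∀ a b c d → a +ℕ b +ℕ (c +ℕ d) ≡ a +ℕ c +ℕ (b +ℕ d)
  interchange = solve-∀

sum-applyUpTo-const : ∀ c n → sum (applyUpTo (λ _ → c) n) ≡ n *ℕ c
sum-applyUpTo-const c zero    = refl
sum-applyUpTo-const c (suc n) = cong (c +ℕ_) (sum-applyUpTo-const c n)

sum-applyUpTo-*ˡ : ∀ c f n → sum (applyUpTo (λ k → c *ℕ f k) n) ≡ c *ℕ sum (applyUpTo f n)
sum-applyUpTo-*ˡ c f zero    = sym (*-zeroʳ c)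
sum-applyUpTo-*ˡ c f (suc n) =
  trans (cong (c *ℕ f 0 +ℕ_) (sum-applyUpTo-*ˡ c (f ∘ suc) n)) (sym (*-distribˡ-+ c (f 0) _))

sum-partial-sums : ∀ b n →
  sum (applyUpTo (λ j → sum (applyUpTo b (suc j))) (suc n)) ≡ sum (applyUpTo (λ k → (n ∸ k +ℕ 1) *ℕ b k) (suc n))
sum-partial-sums b zero    = refl
sum-partial-sums b (suc n) = begin
  b 0 +ℕ 0 +ℕ sum (applyUpTo (λ j → b 0 +ℕ partial j) (suc n))
    ≡⟨ cong (b 0 +ℕ 0 +ℕ_) (sum-applyUpTo-+ (λ _ → b 0) partial (suc n)) ⟩
  b 0 +ℕ 0 +ℕ (sum (applyUpTo (λ _ → b 0) (suc n)) +ℕ sum (applyUpTo partial (suc n)))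
    ≡⟨ cong₂ (λ x y → b 0 +ℕ 0 +ℕ (x +ℕ y)) (sum-applyUpTo-const (b 0) (suc n)) (sum-partial-sums (b ∘ suc) n) ⟩
  b 0 +ℕ 0 +ℕ (suc n *ℕ b 0 +ℕ weighted)
    ≡⟨ regroup n (b 0) weighted ⟩
  (suc n +ℕ 1) *ℕ b 0 +ℕ weighted
    ∎
  where
  open ≡-Reasoning
  partial : ℕ → ℕ
  partial j = sum (applyUpTo (b ∘ suc) (suc j))
  weighted : ℕ
  weighted = sum (applyUpTo (λ k → (n ∸ k +ℕ 1) *ℕ b (suc k)) (suc n))
  regroup : ∀ n x y → x +ℕ 0 +ℕ (suc n *ℕ x +ℕ y) ≡ (suc n +ℕ 1) *ℕ x +ℕ y
  regroup = solve-∀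

hockey-stick : ∀ a j → sum (applyUpTo (λ k → (a +ℕ k) C k) (suc j)) ≡ suc (a +ℕ j) C j
hockey-stick a zero    = refl
hockey-stick a (suc j) = begin
  sum (applyUpTo diagonal (suc (suc j)))      ≡⟨ sum-applyUpTo-suc diagonal (suc j) ⟩
  sum (applyUpTo diagonal (suc j)) +ℕ diagonal (suc j)
    ≡⟨ cong₂ _+ℕ_ (hockey-stick a j) (cong (_C suc j) (+-suc a j)) ⟩
  suc (a +ℕ j) C j +ℕ suc (a +ℕ j) C suc j    ≡⟨ nCk+nC[k+1]≡[n+1]C[k+1] (suc (a +ℕ j)) j ⟩
  suc (suc (a +ℕ j)) C suc j                  ≡⟨ cong (λ x → suc x C suc j) (+-suc a j) ⟨
  suc (a +ℕ suc j) C suc j                    ∎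
  where
  open ≡-Reasoning
  diagonal : ℕ → ℕ
  diagonal k = (a +ℕ k) C k

weighted-hockey-stick : ∀ a n →
  sum (applyUpTo (λ k → (n ∸ k +ℕ 1) *ℕ ((a +ℕ k) C k)) (suc n)) ≡ suc (suc a +ℕ n) C n
weighted-hockey-stick a n = begin
  sum (applyUpTo (λ k → (n ∸ k +ℕ 1) *ℕ ((a +ℕ k) C k)) (suc n))
    ≡⟨ sum-partial-sums (λ k → (a +ℕ k) C k) n ⟨
  sum (applyUpTo (λ j → sum (applyUpTo (λ k → (a +ℕ k) C k) (suc j))) (suc n))
    ≡⟨ cong sum (applyUpTo-cong (hockey-stick a) (suc n)) ⟩
  sum (applyUpTo (λ j → (suc a +ℕ j) C j) (suc n))
    ≡⟨ hockey-stick (suc a) n ⟩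
  suc (suc a +ℕ n) C n
    ∎
  where open ≡-Reasoning

[m+n]Cm≡[m+n]Cn : ∀ m n → (m +ℕ n) C m ≡ (m +ℕ n) C n
[m+n]Cm≡[m+n]Cn m n = trans (nCk≡nC[n∸k] (m≤m+n m n)) (cong ((m +ℕ n) C_) (m+n∸m≡n m n))

F-antidiagonal : ∀ m {k ℓ n} → k +ℕ ℓ ≡ n →
  F k ℓ m ≡ + (((n +ℕ m) C n) *ℕ ((ℓ +ℕ 1) *ℕ ((n +ℕ m +ℕ k) C k))) / suc n
F-antidiagonal m {k} {ℓ} refl = begin
  F k ℓ m
    ≡⟨ [i/d]*[j/1]≡[i*j]/d (+ (ℓ +ℕ 1)) (+ (A *ℕ ((2 *ℕ k +ℕ ℓ +ℕ m) C N))) n ⟩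
  (+ (ℓ +ℕ 1) ℤ.* + (A *ℕ ((2 *ℕ k +ℕ ℓ +ℕ m) C N))) / suc n
    ≡⟨ cong (_/ suc n) (pos-* (ℓ +ℕ 1) _) ⟨
  + ((ℓ +ℕ 1) *ℕ (A *ℕ ((2 *ℕ k +ℕ ℓ +ℕ m) C N))) / suc n
    ≡⟨ cong (λ x → + x / suc n) (reorder (ℓ +ℕ 1) A _) ⟩
  + (A *ℕ ((ℓ +ℕ 1) *ℕ ((2 *ℕ k +ℕ ℓ +ℕ m) C N))) / suc n
    ≡⟨ cong (λ x → + (A *ℕ ((ℓ +ℕ 1) *ℕ (x C N))) / suc n) (upper-index k ℓ m) ⟩
  + (A *ℕ ((ℓ +ℕ 1) *ℕ ((N +ℕ k) C N))) / suc n
    ≡⟨ cong (λ x → + (A *ℕ ((ℓ +ℕ 1) *ℕ x)) / suc n) ([m+n]Cm≡[m+n]Cn N k) ⟩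
  + (A *ℕ ((ℓ +ℕ 1) *ℕ ((N +ℕ k) C k))) / suc n
    ∎
  where
  open ≡-Reasoning
  n N A : ℕ
  n = k +ℕ ℓ
  N = n +ℕ m
  A = N C n
  reorder : ∀ w a b → w *ℕ (a *ℕ b) ≡ a *ℕ (w *ℕ b)
  reorder = solve-∀
  upper-index : ∀ k ℓ m → 2 *ℕ k +ℕ ℓ +ℕ m ≡ k +ℕ ℓ +ℕ m +ℕ k
  upper-index = solve-∀

f-as-fraction : ∀ n m → f n m ≡ + (((m +ℕ n) C n) *ℕ ((2 *ℕ n +ℕ m +ℕ 2) C n)) / suc n
f-as-fraction n m =
  trans ([i/d]*[j/1]≡[i*j]/d (+ 1) (+ binomials) n) (cong (_/ suc n) (ℤ-*-identityˡ (+ binomials)))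
  where
  binomials : ℕ
  binomials = ((m +ℕ n) C n) *ℕ ((2 *ℕ n +ℕ m +ℕ 2) C n)

antidiagonal-numerator-sum : ∀ n m →
  sum (applyUpTo (λ k → ((n +ℕ m) C n) *ℕ ((n ∸ k +ℕ 1) *ℕ ((n +ℕ m +ℕ k) C k))) (suc n))
    ≡ ((m +ℕ n) C n) *ℕ ((2 *ℕ n +ℕ m +ℕ 2) C n)
antidiagonal-numerator-sum n m = begin
  sum (applyUpTo (λ k → A *ℕ ((n ∸ k +ℕ 1) *ℕ ((n +ℕ m +ℕ k) C k))) (suc n))
    ≡⟨ sum-applyUpTo-*ˡ A (λ k → (n ∸ k +ℕ 1) *ℕ ((n +ℕ m +ℕ k) C k)) (suc n) ⟩
  A *ℕ sum (applyUpTo (λ k → (n ∸ k +ℕ 1) *ℕ ((n +ℕ m +ℕ k) C k)) (suc n))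
    ≡⟨ cong (A *ℕ_) (weighted-hockey-stick (n +ℕ m) n) ⟩
  A *ℕ (suc (suc (n +ℕ m) +ℕ n) C n)
    ≡⟨ cong₂ (λ x y → (x C n) *ℕ (y C n)) (+-comm n m) (upper-index n m) ⟩
  ((m +ℕ n) C n) *ℕ ((2 *ℕ n +ℕ m +ℕ 2) C n)
    ∎
  where
  open ≡-Reasoning
  A : ℕ
  A = (n +ℕ m) C n
  upper-index : ∀ n m → suc (suc (n +ℕ m) +ℕ n) ≡ 2 *ℕ n +ℕ m +ℕ 2
  upper-index = solve-∀

lemma4 : (n m : ℕ) → subst-y≔x F n m ≡ f n m
lemma4 n m = begin
  subst-y≔x F n m
    ≡⟨ cong (foldr _+_ 0ℚ) (map-cong-local (applyUpTo⁺₁ id (suc n) on-antidiagonal)) ⟩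
  foldr _+_ 0ℚ (map (λ k → + numerator k / suc n) (upTo (suc n)))
    ≡⟨ cong (foldr _+_ 0ℚ) (map-∘ {g = λ a → + a / suc n} {f = numerator} (upTo (suc n))) ⟩
  foldr _+_ 0ℚ (map (λ a → + a / suc n) (map numerator (upTo (suc n))))
    ≡⟨ foldr-+-map-/ n (map numerator (upTo (suc n))) ⟩
  + sum (map numerator (upTo (suc n))) / suc n
    ≡⟨ cong (λ a → + sum a / suc n) (map-upTo numerator (suc n)) ⟩
  + sum (applyUpTo numerator (suc n)) / suc n
    ≡⟨ cong (λ a → + a / suc n) (antidiagonal-numerator-sum n m) ⟩
  + (((m +ℕ n) C n) *ℕ ((2 *ℕ n +ℕ m +ℕ 2) C n)) / suc n
    ≡⟨ f-as-fraction n m ⟨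
  f n m
    ∎
  where
  open ≡-Reasoning
  numerator : ℕ → ℕ
  numerator k = ((n +ℕ m) C n) *ℕ ((n ∸ k +ℕ 1) *ℕ ((n +ℕ m +ℕ k) C k))
  on-antidiagonal : ∀ {k} → k < suc n → F k (n ∸ k) m ≡ + numerator k / suc n
  on-antidiagonal {k} k<1+n = F-antidiagonal m {k} {n ∸ k} (m+[n∸m]≡n (s≤s⁻¹ k<1+n))
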